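{- Ortholattices admit interpolation: for any quantifier-free formulas $A,B$ such that $A\leq B$ holds in the theory of ortholattices, there exists a quantifier-free formula $I$ with $A\leq I$ and $I\leq B$ and $\mathrm{FV}(I)\subseteq\mathrm{FV}(A)\cap\mathrm{FV}(B)$.
   Context: Formulas are terms over variables, constants $0,1$ and operations $\land,\lor,\neg$. An ortholattice is a bounded lattice with a unary operation $\neg$ satisfying $\neg\neg x=x$, $x\lor\neg x=1$, $x\land\neg x=0$, $\neg(x\lor y)=\neg x\land\neg y$, $\neg(x\land y)=\neg x\lor\neg y$ (distributivity not required); its order is $a\leq b$ iff $a\land b=a$. For formulas, $A\leq B$ means that $A\leq B$ holds in every ortholattice under every assignment of the variables (equivalently, the inequality follows from the ortholattice axioms). $\mathrm{FV}$ denotes the set of variables occurring in a formula. -}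

module Defs where

open import Level using (Level; suc; _⊔_)
open import Data.Nat using (ℕ)
open import Data.Product using (_×_)
open import Data.Sum using (_⊎_)
open import Relation.Binary.Core using (Rel)
open import Algebra.Core using (Op₁; Op₂)
open import Algebra.Lattice.Structures using (IsLattice)

record IsOrtholattice {a ℓ} {A : Set a} (_≈_ : Rel A ℓ)
                      (_∨_ _∧_ : Op₂ A) (¬_ : Op₁ A) (⊤ ⊥ : A) : Set (a ⊔ ℓ) where
  field
    isLattice  : IsLattice _≈_ _∨_ _∧_
    ¬-cong     : ∀ {x y} → x ≈ y → (¬ x) ≈ (¬ y)
    ⊤-max      : ∀ x → (x ∧ ⊤) ≈ x
    ⊥-min      : ∀ x → (⊥ ∧ x) ≈ ⊥
    ¬-invol    : ∀ x → (¬ (¬ x)) ≈ x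
    excl-mid   : ∀ x → (x ∨ (¬ x)) ≈ ⊤
    noncontra  : ∀ x → (x ∧ (¬ x)) ≈ ⊥
    deMorgan-∨ : ∀ x y → (¬ (x ∨ y)) ≈ ((¬ x) ∧ (¬ y))
    deMorgan-∧ : ∀ x y → (¬ (x ∧ y)) ≈ ((¬ x) ∨ (¬ y))

record Ortholattice (a ℓ : Level) : Set (suc (a ⊔ ℓ)) where
  infixr 7 _∧_
  infixr 6 _∨_
  field
    Carrier : Set a
    _≈_     : Rel Carrier ℓ
    _∨_     : Op₂ Carrier
    _∧_     : Op₂ Carrier
    ¬_      : Op₁ Carrier
    ⊤       : Carrier
    ⊥       : Carrier
    isOrtholattice : IsOrtholattice _≈_ _∨_ _∧_ ¬_ ⊤ ⊥

  _≤_ : Rel Carrier ℓ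
  a ≤ b = (a ∧ b) ≈ a

data Formula : Set where
  var  : ℕ → Formula
  `0   : Formula
  `1   : Formula
  _`∧_ : Formula → Formula → Formula
  _`∨_ : Formula → Formula → Formula
  `¬_  : Formula → Formula

⟦_⟧ : ∀ {a ℓ} → Formula → (L : Ortholattice a ℓ) → (ℕ → Ortholattice.Carrier L) → Ortholattice.Carrier L
⟦ var n ⟧ L ρ = ρ n
⟦ `0 ⟧ L ρ = Ortholattice.⊥ L
⟦ `1 ⟧ L ρ = Ortholattice.⊤ L
⟦ A `∧ B ⟧ L ρ = Ortholattice._∧_ L (⟦ A ⟧ L ρ) (⟦ B ⟧ L ρ)
⟦ A `∨ B ⟧ L ρ = Ortholattice._∨_ L (⟦ A ⟧ L ρ) (⟦ B ⟧ L ρ)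
⟦ `¬ A ⟧ L ρ = Ortholattice.¬_ L (⟦ A ⟧ L ρ)

_⊑_ : Formula → Formula → Set₁
A ⊑ B = (L : Ortholattice Level.zero Level.zero) (ρ : ℕ → Ortholattice.Carrier L) →
        Ortholattice._≤_ L (⟦ A ⟧ L ρ) (⟦ B ⟧ L ρ)

data _∈FV_ (x : ℕ) : Formula → Set where
  here  : x ∈FV var x
  ∧ˡ    : ∀ {A B} → x ∈FV A → x ∈FV (A `∧ B)
  ∧ʳ    : ∀ {A B} → x ∈FV B → x ∈FV (A `∧ B)
  ∨ˡ    : ∀ {A B} → x ∈FV A → x ∈FV (A `∨ B)
  ∨ʳ    : ∀ {A B} → x ∈FV B → x ∈FV (A `∨ B)
  ¬∈    : ∀ {A} → x ∈FV A → x ∈FV (`¬ A)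

{-# OPTIONS --safe #-}
module Submission where

-- Interpolation is read off a cut-free sequent calculus for orthologic whose sequents hold
-- at most two annotated formulas: by induction on a derivation of ⊢ p , q, a rule acting on
-- p keeps the interpolant of its premise (or joins the two), and exchange negates it.
-- The calculus is complete without cut by Okada's argument: on the orthoframe of annotated
-- formulas, with provability as orthogonality, the closed sets ⟪ φ ⟫ make the formulas an
-- ortholattice in which φ ᴸ ∈ ⟪ φ ⟫ ⊆ { p ∣ ⊢ p , φ ᴿ }, so A ≤ B there yields ⊢ A ᴸ , B ᴿ.

open import Defs
open import Level using (0ℓ)
open import Data.Nat using (ℕ)
open import Data.Product using (Σ; _×_; _,_; proj₁; proj₂; <_,_>; map; swap)
open import Data.Sum using (inj₁; inj₂; [_,_]′)
open import Data.Unit using (tt)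
open import Function using (id; _∘_; _on_)
open import Relation.Binary using (Rel; Symmetric)
open import Relation.Binary.PropositionalEquality using (_≡_; refl; cong; cong₂; subst₂)
open import Relation.Unary using (Pred; _∈_; _⊆_; _≐_; _∪_; _∩_; U; ｛_｝)
open import Relation.Unary.Properties using (≐-trans)
open import Relation.Unary.Relation.Binary.Subset using (⊆-isPartialOrder)
import Algebra.Lattice.Bundles as Alg
import Algebra.Lattice.Properties.Lattice as AlgLatticeProperties
import Relation.Binary.Construct.On as On
import Relation.Binary.Lattice as Ord
import Relation.Binary.Lattice.Properties.Lattice as OrdLatticeProperties

data Annotated : Set where
  _ᴸ _ᴿ : Formula → Annotated

formula : Annotated → Formula
formula (φ ᴸ) = φ
formula (φ ᴿ) = φ

infix 4 ⊢_,_

-- ⊢ p , p stands for the one-formula sequent ⊢ p; there is no cut rule.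
data ⊢_,_ : Annotated → Annotated → Set where
  ax       : ∀ φ → ⊢ φ ᴸ , φ ᴿ
  exchange : ∀ {p q} → ⊢ p , q → ⊢ q , p
  weaken   : ∀ {p q} → ⊢ p , p → ⊢ p , q
  1R       : ∀ {q} → ⊢ `1 ᴿ , q
  0L       : ∀ {q} → ⊢ `0 ᴸ , q
  ∧L₁      : ∀ {φ ψ q} → ⊢ φ ᴸ , q → ⊢ (φ `∧ ψ) ᴸ , q
  ∧L₂      : ∀ {φ ψ q} → ⊢ ψ ᴸ , q → ⊢ (φ `∧ ψ) ᴸ , q
  ∧R       : ∀ {φ ψ q} → ⊢ φ ᴿ , q → ⊢ ψ ᴿ , q → ⊢ (φ `∧ ψ) ᴿ , q
  ∨L       : ∀ {φ ψ q} → ⊢ φ ᴸ , q → ⊢ ψ ᴸ , q → ⊢ (φ `∨ ψ) ᴸ , q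
  ∨R₁      : ∀ {φ ψ q} → ⊢ φ ᴿ , q → ⊢ (φ `∨ ψ) ᴿ , q
  ∨R₂      : ∀ {φ ψ q} → ⊢ ψ ᴿ , q → ⊢ (φ `∨ ψ) ᴿ , q
  ¬L       : ∀ {φ q} → ⊢ φ ᴿ , q → ⊢ (`¬ φ) ᴸ , q
  ¬R       : ∀ {φ q} → ⊢ φ ᴸ , q → ⊢ (`¬ φ) ᴿ , q

_⊆FV_ : Formula → Formula → Set
φ ⊆FV ψ = ∀ {x} → x ∈FV φ → x ∈FV ψ

record Interpolant (p q : Annotated) : Set where
  field
    I     : Formula
    left  : ⊢ p , I ᴿ
    right : ⊢ I ᴸ , q
    vars  : (x : ℕ) → x ∈FV I → (x ∈FV formula p) × (x ∈FV formula q)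

module _ {p q : Annotated} where

  interpolant-0 : ⊢ p , `0 ᴿ → Interpolant p q
  interpolant-0 d = record { I = `0 ; left = d ; right = 0L ; vars = λ _ () }

  negate : Interpolant q p → Interpolant p q
  negate J = record
    { I = `¬ I ; left = exchange (¬R right) ; right = ¬L (exchange left)
    ; vars = λ { x (¬∈ x∈I) → swap (vars x x∈I) } }
    where open Interpolant J

  extend : ∀ {p′} → (∀ {r} → ⊢ p′ , r → ⊢ p , r) → formula p′ ⊆FV formula p →
           Interpolant p′ q → Interpolant p q
  extend rule p′⊆p J = record
    { I = I ; left = rule left ; right = right
    ; vars = λ x x∈I → map p′⊆p id (vars x x∈I) }
    where open Interpolant J

  merge : ∀ {p₁ p₂} → (∀ {r} → ⊢ p₁ , r → ⊢ p₂ , r → ⊢ p , r) →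
          formula p₁ ⊆FV formula p → formula p₂ ⊆FV formula p →
          Interpolant p₁ q → Interpolant p₂ q → Interpolant p q
  merge rule p₁⊆p p₂⊆p J₁ J₂ = record
    { I = J₁.I `∨ J₂.I
    ; left = rule (exchange (∨R₁ (exchange J₁.left))) (exchange (∨R₂ (exchange J₂.left)))
    ; right = ∨L J₁.right J₂.right
    ; vars = λ { x (∨ˡ x∈I) → map p₁⊆p id (J₁.vars x x∈I)
               ; x (∨ʳ x∈I) → map p₂⊆p id (J₂.vars x x∈I) } }
    where module J₁ = Interpolant J₁
          module J₂ = Interpolant J₂

interpolate : ∀ {p q} → ⊢ p , q → Interpolant p q
interpolate (ax φ) = record { I = φ ; left = ax φ ; right = ax φ ; vars = λ _ x∈φ → x∈φ , x∈φ }
interpolate (exchange d) = negate (interpolate d)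
interpolate (weaken d) = interpolant-0 (weaken d)
interpolate 1R = interpolant-0 1R
interpolate 0L = interpolant-0 0L
interpolate (∧L₁ d) = extend ∧L₁ ∧ˡ (interpolate d)
interpolate (∧L₂ d) = extend ∧L₂ ∧ʳ (interpolate d)
interpolate (∧R d e) = merge ∧R ∧ˡ ∧ʳ (interpolate d) (interpolate e)
interpolate (∨L d e) = merge ∨L ∨ˡ ∨ʳ (interpolate d) (interpolate e)
interpolate (∨R₁ d) = extend ∨R₁ ∨ˡ (interpolate d)
interpolate (∨R₂ d) = extend ∨R₂ ∨ʳ (interpolate d)
interpolate (¬L d) = extend ¬L ¬∈ (interpolate d)
interpolate (¬R d) = extend ¬R ¬∈ (interpolate d)

module Soundness {a ℓ} (L : Ortholattice a ℓ) (ρ : ℕ → Ortholattice.Carrier L) where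

  open Ortholattice L hiding (_≤_)
  open IsOrtholattice isOrtholattice

  lattice : Alg.Lattice a ℓ
  lattice = record
    { Carrier = Carrier ; _≈_ = _≈_ ; _∨_ = _∨_ ; _∧_ = _∧_ ; isLattice = isLattice }

  -- The library order is x ≈ x ∧ y, the symmetric form of Ortholattice._≤_.
  open AlgLatticeProperties lattice using (poset; ∨-∧-orderTheoreticLattice)
  open Ord.Lattice ∨-∧-orderTheoreticLattice
    renaming (refl to ≤-refl)
    using (_≤_; module Eq; trans; reflexive; x∧y≤x; x∧y≤y; y≤x∨y; ∨-least; ∧-greatest)
  open import Relation.Binary.Reasoning.PartialOrder poset

  ¬-antitone : ∀ {x y} → x ≤ y → ¬ y ≤ ¬ x
  ¬-antitone {x} {y} x≈x∧y = begin
    ¬ y          ≤⟨ y≤x∨y (¬ x) (¬ y) ⟩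
    ¬ x ∨ ¬ y    ≈⟨ deMorgan-∧ x y ⟨
    ¬ (x ∧ y)    ≈⟨ ¬-cong x≈x∧y ⟨
    ¬ x          ∎

  ⊥-least : ∀ x → ⊥ ≤ x
  ⊥-least x = Eq.sym (⊥-min x)

  ⊤-greatest : ∀ x → x ≤ ⊤
  ⊤-greatest x = Eq.sym (⊤-max x)

  _⟂_ : Rel Carrier ℓ
  x ⟂ y = x ≤ ¬ y

  ⟂-sym : Symmetric _⟂_
  ⟂-sym {x} {y} x⟂y = begin
    y        ≈⟨ ¬-invol y ⟨
    ¬ ¬ y    ≤⟨ ¬-antitone x⟂y ⟩
    ¬ x      ∎

  ⟂-absurd : ∀ {x y} → x ⟂ x → x ⟂ y
  ⟂-absurd {x} {y} x⟂x = begin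
    x          ≤⟨ ∧-greatest ≤-refl x⟂x ⟩
    x ∧ ¬ x    ≈⟨ noncontra x ⟩
    ⊥          ≤⟨ ⊥-least (¬ y) ⟩
    ¬ y        ∎

  ⟦_⟧ᵃ : Annotated → Carrier
  ⟦ φ ᴸ ⟧ᵃ = ⟦ φ ⟧ L ρ
  ⟦ φ ᴿ ⟧ᵃ = ¬ ⟦ φ ⟧ L ρ

  sound : ∀ {p q} → ⊢ p , q → ⟦ p ⟧ᵃ ⟂ ⟦ q ⟧ᵃ
  sound (ax φ) = reflexive (Eq.sym (¬-invol _))
  sound (exchange d) = ⟂-sym (sound d)
  sound (weaken d) = ⟂-absurd (sound d)
  sound 1R = ¬-antitone (⊤-greatest _)
  sound {q = q} 0L = ⊥-least (¬ ⟦ q ⟧ᵃ)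
  sound (∧L₁ d) = trans (x∧y≤x _ _) (sound d)
  sound (∧L₂ d) = trans (x∧y≤y _ _) (sound d)
  sound (∧R d e) = trans (reflexive (deMorgan-∧ _ _)) (∨-least (sound d) (sound e))
  sound (∨L d e) = ∨-least (sound d) (sound e)
  sound (∨R₁ d) = trans (reflexive (deMorgan-∨ _ _)) (trans (x∧y≤x _ _) (sound d))
  sound (∨R₂ d) = trans (reflexive (deMorgan-∨ _ _)) (trans (x∧y≤y _ _) (sound d))
  sound (¬L d) = sound d
  sound (¬R d) = trans (reflexive (¬-invol _)) (sound d)

  ⊢ᴸᴿ⇒≈∧ : ∀ {φ ψ} → ⊢ φ ᴸ , ψ ᴿ → (⟦ φ ⟧ L ρ ∧ ⟦ ψ ⟧ L ρ) ≈ ⟦ φ ⟧ L ρ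
  ⊢ᴸᴿ⇒≈∧ {ψ = ψ} d = Eq.sym (trans (sound d) (reflexive (¬-invol (⟦ ψ ⟧ L ρ))))

⊢⇒⊑ : ∀ {φ ψ} → ⊢ φ ᴸ , ψ ᴿ → φ ⊑ ψ
⊢⇒⊑ d L ρ = Soundness.⊢ᴸᴿ⇒≈∧ L ρ d

module Orthoframe {A : Set} (_⟂_ : Rel A 0ℓ) (⟂-sym : Symmetric _⟂_)
                  (⟂-absurd : ∀ {x y} → x ⟂ x → x ⟂ y) where

  infix 9 _ᗮ

  _ᗮ : Pred A 0ℓ → Pred A 0ℓ
  (Y ᗮ) x = ∀ {y} → y ∈ Y → x ⟂ y

  Closed : Pred A 0ℓ → Set
  Closed Y = Y ᗮ ᗮ ⊆ Y

  private variable Y Z : Pred A 0ℓ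

  ᗮ-antitone : Y ⊆ Z → Z ᗮ ⊆ Y ᗮ
  ᗮ-antitone Y⊆Z x∈Zᗮ y∈Y = x∈Zᗮ (Y⊆Z y∈Y)

  ᗮᗮ-least : Y ⊆ Z → Closed Z → Y ᗮ ᗮ ⊆ Z
  ᗮᗮ-least Y⊆Z Z-closed x∈Yᗮᗮ = Z-closed (ᗮ-antitone (ᗮ-antitone Y⊆Z) x∈Yᗮᗮ)

  ∩-closed : Closed Y → Closed Z → Closed (Y ∩ Z)
  ∩-closed Y-closed Z-closed x∈Y∩Zᗮᗮ =
    Y-closed (ᗮ-antitone (ᗮ-antitone proj₁) x∈Y∩Zᗮᗮ) ,
    Z-closed (ᗮ-antitone (ᗮ-antitone proj₂) x∈Y∩Zᗮᗮ)

  ᗮ-∪ : (Y ∪ Z) ᗮ ≐ Y ᗮ ∩ Z ᗮ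
  ᗮ-∪ = < ᗮ-antitone inj₁ , ᗮ-antitone inj₂ > , λ (x∈Yᗮ , x∈Zᗮ) → [ x∈Yᗮ , x∈Zᗮ ]′

  ⊆ᗮᗮ : Y ⊆ Y ᗮ ᗮ
  ⊆ᗮᗮ x∈Y y∈Yᗮ = ⟂-sym (y∈Yᗮ x∈Y)

  ᗮ-closed : Closed (Y ᗮ)
  ᗮ-closed = ᗮ-antitone ⊆ᗮᗮ

  ᗮᗮᗮ : Y ᗮ ᗮ ᗮ ≐ Y ᗮ
  ᗮᗮᗮ = ᗮ-closed , ⊆ᗮᗮ

  Uᗮ-least : Closed Y → U ᗮ ⊆ Y
  Uᗮ-least Y-closed x∈Uᗮ = Y-closed (λ _ → x∈Uᗮ tt)

  ᗮ-noncontradiction : Y ∩ Y ᗮ ⊆ U ᗮ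
  ᗮ-noncontradiction (x∈Y , x∈Yᗮ) _ = ⟂-absurd (x∈Yᗮ x∈Y)

  ᗮ-excluded-middle : U ⊆ (Y ∪ Y ᗮ) ᗮ ᗮ
  ᗮ-excluded-middle {Y} x∈U = ᗮ-antitone ∪ᗮ⊆Uᗮ (⊆ᗮᗮ x∈U)
    where
    ∪ᗮ⊆Uᗮ : (Y ∪ Y ᗮ) ᗮ ⊆ U ᗮ
    ∪ᗮ⊆Uᗮ x∈[Y∪Yᗮ]ᗮ = ᗮ-noncontradiction (proj₁ ᗮ-∪ x∈[Y∪Yᗮ]ᗮ)

  ᗮ-∩ : Closed Y → Closed Z → (Y ∩ Z) ᗮ ≐ (Y ᗮ ∪ Z ᗮ) ᗮ ᗮ
  ᗮ-∩ {Y} {Z} Y-closed Z-closed =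
    ᗮ-antitone ᗮ∪ᗮ⊆∩ , ᗮᗮ-least [ ᗮ-antitone proj₁ , ᗮ-antitone proj₂ ]′ ᗮ-closed
    where
    ᗮ∪ᗮ⊆∩ : (Y ᗮ ∪ Z ᗮ) ᗮ ⊆ Y ∩ Z
    ᗮ∪ᗮ⊆∩ x∈[Yᗮ∪Zᗮ]ᗮ = map Y-closed Z-closed (proj₁ ᗮ-∪ x∈[Yᗮ∪Zᗮ]ᗮ)

open Orthoframe ⊢_,_ exchange weaken

⟪_⟫ : Formula → Pred Annotated 0ℓ
⟪ var n ⟫ = ｛ var n ᴿ ｝ ᗮ
⟪ `0 ⟫ = U ᗮ
⟪ `1 ⟫ = U
⟪ φ `∧ ψ ⟫ = ⟪ φ ⟫ ∩ ⟪ ψ ⟫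
⟪ φ `∨ ψ ⟫ = (⟪ φ ⟫ ∪ ⟪ ψ ⟫) ᗮ ᗮ
⟪ `¬ φ ⟫ = ⟪ φ ⟫ ᗮ

⟪⟫-closed : ∀ φ → Closed ⟪ φ ⟫
⟪⟫-closed (var n) = ᗮ-closed
⟪⟫-closed `0 = ᗮ-closed
⟪⟫-closed `1 _ = tt
⟪⟫-closed (φ `∧ ψ) = ∩-closed (⟪⟫-closed φ) (⟪⟫-closed ψ)
⟪⟫-closed (φ `∨ ψ) = ᗮ-closed
⟪⟫-closed (`¬ φ) = ᗮ-closed

⟪⟫⊆⊢ᴿ : ∀ φ {p} → p ∈ ⟪ φ ⟫ → ⊢ p , φ ᴿ
ᴸ∈⟪⟫ : ∀ φ → φ ᴸ ∈ ⟪ φ ⟫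

⟪⟫⊆⊢ᴿ (var n) p∈⟪φ⟫ = p∈⟪φ⟫ refl
⟪⟫⊆⊢ᴿ `0 p∈⟪φ⟫ = p∈⟪φ⟫ tt
⟪⟫⊆⊢ᴿ `1 _ = exchange 1R
⟪⟫⊆⊢ᴿ (φ `∧ ψ) (p∈⟪φ⟫ , p∈⟪ψ⟫) =
  exchange (∧R (exchange (⟪⟫⊆⊢ᴿ φ p∈⟪φ⟫)) (exchange (⟪⟫⊆⊢ᴿ ψ p∈⟪ψ⟫)))
⟪⟫⊆⊢ᴿ (φ `∨ ψ) p∈⟪φ∨ψ⟫ = p∈⟪φ∨ψ⟫ [ (λ q∈⟪φ⟫ → ∨R₁ (exchange (⟪⟫⊆⊢ᴿ φ q∈⟪φ⟫)))
                                   , (λ q∈⟪ψ⟫ → ∨R₂ (exchange (⟪⟫⊆⊢ᴿ ψ q∈⟪ψ⟫))) ]′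
⟪⟫⊆⊢ᴿ (`¬ φ) p∈⟪¬φ⟫ = exchange (¬R (exchange (p∈⟪¬φ⟫ (ᴸ∈⟪⟫ φ))))

ᴸ∈⟪⟫ (var n) refl = ax (var n)
ᴸ∈⟪⟫ `0 _ = 0L
ᴸ∈⟪⟫ `1 = tt
ᴸ∈⟪⟫ (φ `∧ ψ) =
  ⟪⟫-closed φ (λ q∈⟪φ⟫ᗮ → ∧L₁ (exchange (q∈⟪φ⟫ᗮ (ᴸ∈⟪⟫ φ)))) ,
  ⟪⟫-closed ψ (λ q∈⟪ψ⟫ᗮ → ∧L₂ (exchange (q∈⟪ψ⟫ᗮ (ᴸ∈⟪⟫ ψ))))
ᴸ∈⟪⟫ (φ `∨ ψ) q∈[⟪φ⟫∪⟪ψ⟫]ᗮ =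
  ∨L (exchange (q∈[⟪φ⟫∪⟪ψ⟫]ᗮ (inj₁ (ᴸ∈⟪⟫ φ)))) (exchange (q∈[⟪φ⟫∪⟪ψ⟫]ᗮ (inj₂ (ᴸ∈⟪⟫ ψ))))
ᴸ∈⟪⟫ (`¬ φ) q∈⟪φ⟫ = ¬L (exchange (⟪⟫⊆⊢ᴿ φ q∈⟪φ⟫))

canonicalOrder : Ord.Lattice 0ℓ 0ℓ 0ℓ
canonicalOrder = record
  { Carrier = Formula
  ; _≈_ = _≐_ on ⟪_⟫
  ; _≤_ = _⊆_ on ⟪_⟫
  ; _∨_ = _`∨_
  ; _∧_ = _`∧_
  ; isLattice = record
    { isPartialOrder = On.isPartialOrder ⟪_⟫ ⊆-isPartialOrder
    ; supremum = λ φ ψ → ⊆ᗮᗮ ∘ inj₁ , ⊆ᗮᗮ ∘ inj₂ ,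
                 λ χ φ≤χ ψ≤χ → ᗮᗮ-least [ φ≤χ , ψ≤χ ]′ (⟪⟫-closed χ)
    ; infimum = λ φ ψ → proj₁ , proj₂ , λ χ χ≤φ χ≤ψ → < χ≤φ , χ≤ψ >
    }
  }

canonical : Ortholattice 0ℓ 0ℓ
canonical = record
  { Carrier = Formula
  ; _≈_ = _≐_ on ⟪_⟫
  ; _∨_ = _`∨_
  ; _∧_ = _`∧_
  ; ¬_ = `¬_
  ; ⊤ = `1
  ; ⊥ = `0
  ; isOrtholattice = record
    { isLattice = OrdLatticeProperties.isAlgLattice canonicalOrder
    ; ¬-cong = λ (φ⊆ψ , ψ⊆φ) → ᗮ-antitone ψ⊆φ , ᗮ-antitone φ⊆ψ
    ; ⊤-max = λ φ → proj₁ , (_, tt)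
    ; ⊥-min = λ φ → proj₁ , < id , Uᗮ-least (⟪⟫-closed φ) >
    ; ¬-invol = λ φ → ⟪⟫-closed φ , ⊆ᗮᗮ
    ; excl-mid = λ φ → (λ _ → tt) , ᗮ-excluded-middle
    ; noncontra = λ φ → ᗮ-noncontradiction , < Uᗮ-least (⟪⟫-closed φ) , Uᗮ-least ᗮ-closed >
    ; deMorgan-∨ = λ φ ψ → ≐-trans ᗮᗮᗮ ᗮ-∪
    ; deMorgan-∧ = λ φ ψ → ᗮ-∩ (⟪⟫-closed φ) (⟪⟫-closed ψ)
    }
  }

⟦⟧-canonical-var : ∀ φ → ⟦ φ ⟧ canonical var ≡ φ
⟦⟧-canonical-var (var n) = refl
⟦⟧-canonical-var `0 = refl
⟦⟧-canonical-var `1 = refl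
⟦⟧-canonical-var (φ `∧ ψ) = cong₂ _`∧_ (⟦⟧-canonical-var φ) (⟦⟧-canonical-var ψ)
⟦⟧-canonical-var (φ `∨ ψ) = cong₂ _`∨_ (⟦⟧-canonical-var φ) (⟦⟧-canonical-var ψ)
⟦⟧-canonical-var (`¬ φ) = cong `¬_ (⟦⟧-canonical-var φ)

⊑⇒⊢ : ∀ {φ ψ} → φ ⊑ ψ → ⊢ φ ᴸ , ψ ᴿ
⊑⇒⊢ {φ} {ψ} φ⊑ψ = ⟪⟫⊆⊢ᴿ ψ (proj₂ (⟪φ⟫⊆⟪φ∧ψ⟫ (ᴸ∈⟪⟫ φ)))
  where
  ⟪φ⟫⊆⟪φ∧ψ⟫ : ⟪ φ ⟫ ⊆ ⟪ φ `∧ ψ ⟫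
  ⟪φ⟫⊆⟪φ∧ψ⟫ = subst₂ (λ φ′ ψ′ → ⟪ φ′ ⟫ ⊆ ⟪ φ′ `∧ ψ′ ⟫)
                (⟦⟧-canonical-var φ) (⟦⟧-canonical-var ψ) (proj₂ (φ⊑ψ canonical var))

corollary2 : (A B : Formula) → A ⊑ B →
    Σ Formula (λ I → (A ⊑ I) × (I ⊑ B) ×
      ((x : ℕ) → x ∈FV I → (x ∈FV A) × (x ∈FV B)))
corollary2 A B A⊑B = I , ⊢⇒⊑ left , ⊢⇒⊑ right , vars
  where open Interpolant (interpolate (⊑⇒⊢ {A} {B} A⊑B))
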